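{- Let $n\ge 2$, $1\le k\le n-1$ and $r\ge 1$ be integers. Let $\mathcal{T}_r$ be the set of orbits, under the action of $\mathbb{Z}_n$ by cyclic shifts, of the $k$-subsets $A\subseteq\mathbb{Z}_n$ whose block composition $c(A)$ has length $r$. Let $\mathcal{Z}_{n,k,r}=\mathcal{C}_{k,r}\times\mathcal{C}_{n-k,r}$ with the action of $\mathbb{Z}_r$ by simultaneous cyclic shifts, and let $\mathcal{Z}_{n,k,r}/\mathbb{Z}_r$ be its set of orbits. Then there is a bijection between $\mathcal{T}_r$ and $\mathcal{Z}_{n,k,r}/\mathbb{Z}_r$.
   Context: $\mathbb{Z}_n$ acts on subsets of $\mathbb{Z}_n$ by $(s,A)\mapsto A+s=\{a+s:a\in A\}$ modulo $n$; this preserves cardinality. For $A\subsetneq\mathbb{Z}_n$, the consecutive block structure $\pi(A)=(D_1,\ldots,D_\ell)$ is the partition of $A$ into its maximal subsets of consecutive elements modulo $n$, $D_i=\{d_i,d_i+1,\ldots,d_i+|D_i|-1\}$, ordered by $d_1<\cdots<d_\ell$ (as integers in $\{0,\ldots,n-1\}$), where $d_i$ is the first element of the block ($d_i-1\notin A$). The block composition of $A$ is $c(A)=(|D_1|,\ldots,|D_\ell|)$, of length $\ell$. $\mathcal{C}_{m,r}$ denotes the set of compositions of $m$ of length $r$, i.e. $r$-tuples of positive integers summing to $m$. $\mathbb{Z}_r$ acts on $\mathcal{C}_{m,r}$ by $s\cdot(c_1,\ldots,c_r)=(c_{s+1},\ldots,c_r,c_1,\ldots,c_s)$, and on $\mathcal{C}_{k,r}\times\mathcal{C}_{n-k,r}$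 by $s\cdot(c,c')=(s\cdot c,s\cdot c')$. -}

module Defs where

open import Data.Nat using (ℕ; zero; suc; _+_; _∸_; _≤_)
open import Data.Nat.DivMod using (_mod_)
open import Data.Fin using (Fin; toℕ)
open import Data.Fin.Subset using (Subset; ∣_∣)
open import Data.Bool using (Bool; true; false; _∧_; not; if_then_else_)
open import Data.Vec using (Vec; lookup; tabulate)
open import Data.Vec.Relation.Unary.All using (All)
open import Data.List using (List; filterᵇ; map; length; allFin)
open import Data.Product using (Σ; ∃; _×_; proj₁; proj₂; _,_)
open import Relation.Binary.PropositionalEquality using (_≡_)

addMod : ∀ {n} → Fin n → ℕ → Fin n
addMod {suc m} x t = (toℕ x + t) mod (suc m)

-- The translate A + s = { a + s : a ∈ A } of a subset A ⊆ ℤ_n :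
-- y ∈ A + s  iff  y - s ∈ A,  where y - s = y + (n - s) mod n.
shift : ∀ {n} → Subset n → Fin n → Subset n
shift {n} A s = tabulate (λ y → lookup A (addMod y (n ∸ toℕ s)))

-- d is the first element of a block of A :  d ∈ A and d - 1 ∉ A.
isBlockStart : ∀ {n} → Subset n → Fin n → Bool
isBlockStart {n} A d = lookup A d ∧ not (lookup A (addMod d (n ∸ 1)))

runLength : ∀ {n} → Subset n → Fin n → ℕ → ℕ
runLength A d zero = zero
runLength A d (suc fuel) =
  if lookup A d then suc (runLength A (addMod d 1) fuel) else zero

-- Block composition c(A) = (|D_1|, …, |D_ℓ|), blocks ordered by their
-- first elements d_1 < ⋯ < d_ℓ (allFin n lists 0,…,n-1 increasingly).
-- Meaningful for proper subsets A ⊊ ℤ_n.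
blockComposition : ∀ {n} → Subset n → List ℕ
blockComposition {n} A = map (λ d → runLength A d n) (filterᵇ (isBlockStart A) (allFin n))

vsum : ∀ {r} → Vec ℕ r → ℕ
vsum Vec.[] = 0
vsum (c Vec.∷ cs) = c + vsum cs

IsComposition : (m r : ℕ) → Vec ℕ r → Set
IsComposition m r c = All (λ ci → 1 ≤ ci) c × vsum c ≡ m

rotate : ∀ {r} → Fin r → Vec ℕ r → Vec ℕ r
rotate s c = tabulate (λ i → lookup c (addMod i (toℕ s)))

TSet : (n k r : ℕ) → Set
TSet n k r = Σ (Subset n) λ A → ∣ A ∣ ≡ k × length (blockComposition A) ≡ r

SameShiftOrbit : ∀ {n k r} → TSet n k r → TSet n k r → Set
SameShiftOrbit {n} A B = ∃ λ (s : Fin n) → shift (proj₁ A) s ≡ proj₁ B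

ZSet : (n k r : ℕ) → Set
ZSet n k r = Σ (Vec ℕ r × Vec ℕ r) λ p →
  IsComposition k r (proj₁ p) × IsComposition (n ∸ k) r (proj₂ p)

SameRotOrbit : ∀ {n k r} → ZSet n k r → ZSet n k r → Set
SameRotOrbit {r = r} ((c , c') , _) ((d , d') , _) =
  ∃ λ (s : Fin r) → rotate s c ≡ d × rotate s c' ≡ d'

-- A bijection between the orbit sets X/~ and Y/≈ : a map X → Y that
-- respects and reflects the orbit relations and hits every orbit.
QuotientBijection : (X : Set) → (X → X → Set) → (Y : Set) → (Y → Y → Set) → Set
QuotientBijection X _~_ Y _≈_ =
  Σ (X → Y) λ f →
    (∀ x x' → x ~ x' → f x ≈ f x') ×
    (∀ x x' → f x ≈ f x' → x ~ x') ×
    (∀ y → ∃ λ x → f x ≈ y)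

module Submission where

-- A subset A ⊆ ℤ_N is read as the N-periodic predicate j ↦ (j mod N ∈ A).
-- Listing its blocks by their first elements, each together with the gap
-- that follows it, gives pairs (a₁ , b₁) … (a_r , b_r) of positive numbers;
-- reading the word 1^{a₁} 0^{b₁} ⋯ 1^{a_r} 0^{b_r} from any block start gives
-- back a translate of A.  Translating A by s only changes which block comes
-- first, i.e. cyclically rotates the list of pairs, and conversely rotating
-- the list of pairs rotates the word, i.e. translates the subset.  So
-- A ↦ (block composition, gap composition) induces the bijection on orbits.

open import Defs
open import Data.Bool using (Bool; true; false; _∧_; not; if_then_else_)
open import Data.Bool.Properties using (∧-zeroʳ)
open import Data.Fin as F using (Fin; toℕ)
import Data.Fin.Properties as FP
open import Data.Fin.Subset using (Subset; ∣_∣)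
open import Data.List as L using (List; []; _∷_; _++_; map; filterᵇ; length; replicate; allFin; concatMap)
open import Data.List.Properties hiding (sum-++)
import Data.List.Relation.Unary.All as LA
import Data.List.Relation.Unary.All.Properties as LAP
open import Data.Nat using (ℕ; zero; suc; _+_; _*_; _∸_; _%_; _≤_; _<_; z≤n; s≤s; z<s; s<s; NonZero; _⊓_)
open import Data.Nat.DivMod using (_mod_; m%n<n; m<n⇒m%n≡m; [m+n]%n≡m%n; [m+kn]%n≡m%n; %-distribˡ-+; m%n%n≡m%n; n%n≡0)
open import Data.Nat.ListAction using (sum)
open import Data.Nat.ListAction.Properties using (sum-++)
open import Data.Nat.Properties
open import Data.Nat.Tactic.RingSolver using (solve-∀)
open import Data.Product using (Σ; ∃; _×_; proj₁; proj₂; _,_)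
open import Data.Vec as V using (Vec; lookup)
import Data.Vec.Properties as VP
import Data.Vec.Relation.Unary.All as VA
import Data.Vec.Relation.Unary.All.Properties as VAP
open import Function using (_∘_)
open import Relation.Binary.PropositionalEquality
open import Relation.Nullary using (yes; no; contradiction)
open import Relation.Nullary.Decidable using (T?)

∧-true : ∀ x y → x ∧ y ≡ true → x ≡ true × y ≡ true
∧-true true true refl = refl , refl

not-true : ∀ x → not x ≡ true → x ≡ false
not-true false refl = refl

if-cong : ∀ {A : Set} {b c : Bool} (x y : A) → b ≡ c → (if b then x else y) ≡ (if c then x else y)
if-cong x y refl = refl

range : ℕ → ℕ → List ℕ
range a zero    = []
range a (suc k) = a ∷ range (suc a) k

length-range : ∀ a k → length (range a k) ≡ k
length-range a zero    = refl
length-range a (suc k) = cong suc (length-range (suc a) k)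

range-++ : ∀ a p q → range a (p + q) ≡ range a p ++ range (a + p) q
range-++ a zero    q = cong (λ b → range b q) (sym (+-identityʳ a))
range-++ a (suc p) q = cong (a ∷_) (trans (range-++ (suc a) p q) (cong (λ b → range (suc a) p ++ range b q) (sym (+-suc a p))))

map-+-range : ∀ c a k → map (_+ c) (range a k) ≡ range (a + c) k
map-+-range c a zero    = refl
map-+-range c a (suc k) = cong ((a + c) ∷_) (map-+-range c (suc a) k)

map-range-suc : ∀ {A : Set} (f : ℕ → A) a k → map f (range (suc a) k) ≡ map (f ∘ suc) (range a k)
map-range-suc f a zero    = refl
map-range-suc f a (suc k) = cong (f (suc a) ∷_) (map-range-suc f (suc a) k)

map-range-∷ʳ : ∀ {A : Set} (f : ℕ → A) k → map f (range 0 (suc k)) ≡ map f (range 0 k) L.∷ʳ f k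
map-range-∷ʳ f k = trans (cong (map f) (trans (cong (range 0) (+-comm 1 k)) (range-++ 0 k 1))) (map-++ f (range 0 k) (k ∷ []))

map-cong-range : ∀ {A : Set} (f g : ℕ → A) a k → (∀ j → j < k → f (a + j) ≡ g (a + j)) →
                 map f (range a k) ≡ map g (range a k)
map-cong-range f g a zero    eq = refl
map-cong-range f g a (suc k) eq =
  cong₂ _∷_ (subst (λ i → f i ≡ g i) (+-identityʳ a) (eq 0 z<s))
            (map-cong-range f g (suc a) k (λ j j<k → subst (λ i → f i ≡ g i) (+-suc a j) (eq (suc j) (s<s j<k))))

map-toℕ-allFin : ∀ n → map toℕ (allFin n) ≡ range 0 n
map-toℕ-allFin n = trans (map-tabulate (λ i → i) toℕ) (tabulate-toℕ n 0)
  where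
  tabulate-toℕ : ∀ n a → L.tabulate {n = n} (λ i → a + toℕ i) ≡ range a n
  tabulate-toℕ zero    a = refl
  tabulate-toℕ (suc n) a = cong₂ _∷_ (+-identityʳ a) (trans (tabulate-cong (λ i → +-suc a (toℕ i))) (tabulate-toℕ n (suc a)))

filterᵇ-accept : ∀ {A : Set} (q : A → Bool) x xs → q x ≡ true → filterᵇ q (x ∷ xs) ≡ x ∷ filterᵇ q xs
filterᵇ-accept q x xs qx rewrite qx = refl

filterᵇ-cong : ∀ {A : Set} {p q : A → Bool} → (∀ x → p x ≡ q x) → ∀ xs → filterᵇ p xs ≡ filterᵇ q xs
filterᵇ-cong {p = p} {q} eq []       = refl
filterᵇ-cong {p = p} {q} eq (x ∷ xs) with p x | q x | eq x
... | true  | .true  | refl = cong (x ∷_) (filterᵇ-cong eq xs)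
... | false | .false | refl = filterᵇ-cong eq xs

filterᵇ-head : ∀ {A : Set} (q : A → Bool) xs {x ys} → filterᵇ q xs ≡ x ∷ ys → q x ≡ true
filterᵇ-head q (y ∷ xs) eq with q y in qy
... | true  = trans (cong q (sym (∷-injectiveˡ eq))) qy
... | false = filterᵇ-head q xs eq

filterᵇ-range-none : ∀ (q : ℕ → Bool) a k → (∀ j → j < k → q (a + j) ≡ false) → filterᵇ q (range a k) ≡ []
filterᵇ-range-none q a zero    none = refl
filterᵇ-range-none q a (suc k) none with q a in qa
... | true  = contradiction (trans (sym qa) (trans (cong q (sym (+-identityʳ a))) (none 0 z<s))) λ ()
... | false = filterᵇ-range-none q (suc a) k (λ j j<k → trans (cong q (sym (+-suc a j))) (none (suc j) (s<s j<k)))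

map-filterᵇ-map : ∀ {A B C : Set} (g : A → B) (q : B → Bool) (h : B → C) xs →
                  map h (filterᵇ q (map g xs)) ≡ map (h ∘ g) (filterᵇ (q ∘ g) xs)
map-filterᵇ-map g q h []       = refl
map-filterᵇ-map g q h (x ∷ xs) with q (g x)
... | true  = cong (h (g x) ∷_) (map-filterᵇ-map g q h xs)
... | false = map-filterᵇ-map g q h xs

map-filterᵇ≡concatMap : ∀ {A B : Set} (q : A → Bool) (h : A → B) xs →
                        map h (filterᵇ q xs) ≡ concatMap (λ x → if q x then h x ∷ [] else []) xs
map-filterᵇ≡concatMap q h []       = refl
map-filterᵇ≡concatMap q h (x ∷ xs) with q x
... | true  = cong (h x ∷_) (map-filterᵇ≡concatMap q h xs)
... | false = map-filterᵇ≡concatMap q h xs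

map≡concatMap : ∀ {A B : Set} (h : A → B) xs → map h xs ≡ concatMap (L.[_] ∘ h) xs
map≡concatMap h xs = trans (sym (concatMap-pure (map h xs))) (concatMap-map L.[_] h xs)

lookupOr : ∀ {A : Set} → A → List A → ℕ → A
lookupOr d []       _       = d
lookupOr d (x ∷ xs) zero    = x
lookupOr d (x ∷ xs) (suc j) = lookupOr d xs j

lookupOr-++ˡ : ∀ {A : Set} (d : A) xs ys j → j < length xs → lookupOr d (xs ++ ys) j ≡ lookupOr d xs j
lookupOr-++ˡ d (x ∷ xs) ys zero    _         = refl
lookupOr-++ˡ d (x ∷ xs) ys (suc j) (s≤s j<n) = lookupOr-++ˡ d xs ys j j<n

lookupOr-++ʳ : ∀ {A : Set} (d : A) xs ys j → lookupOr d (xs ++ ys) (length xs + j) ≡ lookupOr d ys j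
lookupOr-++ʳ d []       ys j = refl
lookupOr-++ʳ d (x ∷ xs) ys j = lookupOr-++ʳ d xs ys j

lookupOr-replicate : ∀ {A : Set} (d x : A) k j → j < k → lookupOr d (replicate k x) j ≡ x
lookupOr-replicate d x (suc k) zero    _         = refl
lookupOr-replicate d x (suc k) (suc j) (s≤s j<k) = lookupOr-replicate d x k j j<k

lookupOr-map-range : ∀ {A : Set} (d : A) (f : ℕ → A) a k j → j < k → lookupOr d (map f (range a k)) j ≡ f (a + j)
lookupOr-map-range d f a (suc k) zero    _         = cong f (sym (+-identityʳ a))
lookupOr-map-range d f a (suc k) (suc j) (s≤s j<k) =
  trans (lookupOr-map-range d f (suc a) k j j<k) (cong f (sym (+-suc a j)))

map-lookupOr-range : ∀ {A : Set} (d : A) (w : List A) → map (lookupOr d w) (range 0 (length w)) ≡ w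
map-lookupOr-range d []      = refl
map-lookupOr-range d (x ∷ w) =
  cong (x ∷_) (trans (map-range-suc (lookupOr d (x ∷ w)) 0 (length w)) (map-lookupOr-range d w))

toVecOr : ∀ {A : Set} → A → (n : ℕ) → List A → Vec A n
toVecOr d zero    _        = V.[]
toVecOr d (suc n) []       = d V.∷ toVecOr d n []
toVecOr d (suc n) (x ∷ xs) = x V.∷ toVecOr d n xs

lookup-toVecOr : ∀ {A : Set} (d : A) n xs (i : Fin n) → lookup (toVecOr d n xs) i ≡ lookupOr d xs (toℕ i)
lookup-toVecOr d (suc n) []       F.zero    = refl
lookup-toVecOr d (suc n) []       (F.suc i) = lookup-toVecOr d n [] i
lookup-toVecOr d (suc n) (x ∷ xs) F.zero    = refl
lookup-toVecOr d (suc n) (x ∷ xs) (F.suc i) = lookup-toVecOr d n xs i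

Vec-ext : ∀ {A : Set} {n} (u v : Vec A n) → (∀ i → lookup u i ≡ lookup v i) → u ≡ v
Vec-ext u v eq = trans (sym (VP.tabulate∘lookup u)) (trans (VP.tabulate-cong eq) (VP.tabulate∘lookup v))

map-proj-injective : ∀ {A B : Set} (ps qs : List (A × B)) →
                     map proj₁ ps ≡ map proj₁ qs → map proj₂ ps ≡ map proj₂ qs → ps ≡ qs
map-proj-injective []       []       _   _   = refl
map-proj-injective (p ∷ ps) (q ∷ qs) eq₁ eq₂ =
  cong₂ _∷_ (cong₂ _,_ (∷-injectiveˡ eq₁) (∷-injectiveˡ eq₂))
            (map-proj-injective ps qs (∷-injectiveʳ eq₁) (∷-injectiveʳ eq₂))

%-+ʳ : ∀ n j t .{{_ : NonZero n}} → (j + t % n) % n ≡ (j + t) % n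
%-+ʳ n j t = begin
  (j + t % n) % n          ≡⟨ %-distribˡ-+ j (t % n) n ⟩
  (j % n + t % n % n) % n  ≡⟨ cong (λ z → (j % n + z) % n) (m%n%n≡m%n t n) ⟩
  (j % n + t % n) % n      ≡⟨ %-distribˡ-+ j t n ⟨
  (j + t) % n              ∎
  where open ≡-Reasoning

%-+ˡ : ∀ n j t .{{_ : NonZero n}} → (j % n + t) % n ≡ (j + t) % n
%-+ˡ n j t = trans (cong (_% n) (+-comm (j % n) t)) (trans (%-+ʳ n t j) (cong (_% n) (+-comm t j)))

lookupOr-rotate : ∀ {A : Set} (d : A) n (xs ys : List A) .{{_ : NonZero n}} → length xs + length ys ≡ n →
                  ∀ i → i < n → lookupOr d (ys ++ xs) i ≡ lookupOr d (xs ++ ys) ((i + length xs) % n)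
lookupOr-rotate d n xs ys len i i<n with i <? length ys
... | yes i<ys = begin
    lookupOr d (ys ++ xs) i                    ≡⟨ lookupOr-++ˡ d ys xs i i<ys ⟩
    lookupOr d ys i                            ≡⟨ lookupOr-++ʳ d xs ys i ⟨
    lookupOr d (xs ++ ys) (length xs + i)      ≡⟨ cong (lookupOr d (xs ++ ys)) (+-comm (length xs) i) ⟩
    lookupOr d (xs ++ ys) (i + length xs)      ≡⟨ cong (lookupOr d (xs ++ ys)) (m<n⇒m%n≡m i+xs<n) ⟨
    lookupOr d (xs ++ ys) ((i + length xs) % n) ∎
  where
  open ≡-Reasoning
  i+xs<n : i + length xs < n
  i+xs<n = subst (i + length xs <_) len (subst (_< length xs + length ys) (+-comm (length xs) i) (+-monoʳ-< (length xs) i<ys))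
... | no i≮ys = begin
    lookupOr d (ys ++ xs) i                    ≡⟨ cong (lookupOr d (ys ++ xs)) ys+i≡i ⟨
    lookupOr d (ys ++ xs) (length ys + i′)     ≡⟨ lookupOr-++ʳ d ys xs i′ ⟩
    lookupOr d xs i′                           ≡⟨ lookupOr-++ˡ d xs ys i′ i′<xs ⟨
    lookupOr d (xs ++ ys) i′                   ≡⟨ cong (lookupOr d (xs ++ ys)) wrap ⟨
    lookupOr d (xs ++ ys) ((i + length xs) % n) ∎
  where
  open ≡-Reasoning
  i′ = i ∸ length ys
  ys+i≡i : length ys + i′ ≡ i
  ys+i≡i = m+[n∸m]≡n (≮⇒≥ i≮ys)
  i′<xs : i′ < length xs
  i′<xs = +-cancelˡ-< (length ys) i′ (length xs)
            (subst₂ _<_ (sym ys+i≡i) (sym (trans (+-comm (length ys) (length xs)) len)) i<n)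
  wrap : (i + length xs) % n ≡ i′
  wrap = begin
     (i + length xs) % n                ≡⟨ cong (λ z → (z + length xs) % n) ys+i≡i ⟨
     (length ys + i′ + length xs) % n   ≡⟨ cong (_% n) (shuffle (length ys) i′ (length xs)) ⟩
     (i′ + (length xs + length ys)) % n ≡⟨ cong (λ z → (i′ + z) % n) len ⟩
     (i′ + n) % n                       ≡⟨ [m+n]%n≡m%n i′ n ⟩
     i′ % n                             ≡⟨ m<n⇒m%n≡m (<-≤-trans i′<xs (subst (length xs ≤_) len (m≤m+n (length xs) (length ys)))) ⟩
     i′                                 ∎
    where
    shuffle : ∀ a b c → a + b + c ≡ b + (c + a)
    shuffle = solve-∀

concatMap-range-rotate : ∀ {C : Set} (n u : ℕ) (Φ Ψ : ℕ → List C) → u ≤ n →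
  (∀ j → Φ (j + n) ≡ Φ j) → (∀ j → Ψ j ≡ Φ (j + u)) →
  concatMap Φ (range 0 n) ≡ concatMap Φ (range 0 u) ++ concatMap Φ (range u (n ∸ u)) ×
  concatMap Ψ (range 0 n) ≡ concatMap Φ (range u (n ∸ u)) ++ concatMap Φ (range 0 u)
concatMap-range-rotate n u Φ Ψ u≤n periodic shifted = split , rotated
  where
  open ≡-Reasoning
  u+rest : u + (n ∸ u) ≡ n
  u+rest = m+[n∸m]≡n u≤n
  split : concatMap Φ (range 0 n) ≡ concatMap Φ (range 0 u) ++ concatMap Φ (range u (n ∸ u))
  split = begin
    concatMap Φ (range 0 n)                                   ≡⟨ cong (λ z → concatMap Φ (range 0 z)) u+rest ⟨
    concatMap Φ (range 0 (u + (n ∸ u)))                       ≡⟨ cong (concatMap Φ) (range-++ 0 u (n ∸ u)) ⟩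
    concatMap Φ (range 0 u ++ range u (n ∸ u))                ≡⟨ concatMap-++ Φ (range 0 u) (range u (n ∸ u)) ⟩
    concatMap Φ (range 0 u) ++ concatMap Φ (range u (n ∸ u))  ∎
  shiftRange : ∀ c a k → concatMap Φ (map (_+ c) (range a k)) ≡ concatMap Φ (range (a + c) k)
  shiftRange c a k = cong (concatMap Φ) (map-+-range c a k)
  wrapped : concatMap Φ (range n u) ≡ concatMap Φ (range 0 u)
  wrapped = trans (sym (shiftRange n 0 u)) (trans (concatMap-map Φ (_+ n) (range 0 u)) (concatMap-cong periodic (range 0 u)))
  rotated : concatMap Ψ (range 0 n) ≡ concatMap Φ (range u (n ∸ u)) ++ concatMap Φ (range 0 u)
  rotated = begin
    concatMap Ψ (range 0 n)                                   ≡⟨ concatMap-cong shifted (range 0 n) ⟩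
    concatMap (Φ ∘ (_+ u)) (range 0 n)                        ≡⟨ concatMap-map Φ (_+ u) (range 0 n) ⟨
    concatMap Φ (map (_+ u) (range 0 n))                      ≡⟨ shiftRange u 0 n ⟩
    concatMap Φ (range u n)                                   ≡⟨ cong (λ z → concatMap Φ (range u z)) (m∸n+n≡m u≤n) ⟨
    concatMap Φ (range u ((n ∸ u) + u))                       ≡⟨ cong (concatMap Φ) (range-++ u (n ∸ u) u) ⟩
    concatMap Φ (range u (n ∸ u) ++ range (u + (n ∸ u)) u)    ≡⟨ cong (λ z → concatMap Φ (range u (n ∸ u) ++ range z u)) u+rest ⟩
    concatMap Φ (range u (n ∸ u) ++ range n u)                ≡⟨ concatMap-++ Φ (range u (n ∸ u)) (range n u) ⟩
    concatMap Φ (range u (n ∸ u)) ++ concatMap Φ (range n u)  ≡⟨ cong (concatMap Φ (range u (n ∸ u)) ++_) wrapped ⟩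
    concatMap Φ (range u (n ∸ u)) ++ concatMap Φ (range 0 u)  ∎

-- Words of blocks and gaps

word : List (ℕ × ℕ) → List Bool
word []             = []
word ((a , b) ∷ ps) = replicate a true ++ (replicate b false ++ word ps)

wordLength : List (ℕ × ℕ) → ℕ
wordLength ps = length (word ps)

blockTotal gapTotal : List (ℕ × ℕ) → ℕ
blockTotal ps = sum (map proj₁ ps)
gapTotal   ps = sum (map proj₂ ps)

Positive : ℕ × ℕ → Set
Positive (a , b) = 1 ≤ a × 1 ≤ b

trues : List Bool → ℕ
trues []           = 0
trues (true ∷ xs)  = suc (trues xs)
trues (false ∷ xs) = trues xs

trues-++ : ∀ xs ys → trues (xs ++ ys) ≡ trues xs + trues ys
trues-++ []           ys = refl
trues-++ (true ∷ xs)  ys = cong suc (trues-++ xs ys)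
trues-++ (false ∷ xs) ys = trues-++ xs ys

trues-replicate : ∀ k x → trues (replicate k x) ≡ (if x then k else 0)
trues-replicate zero    true  = refl
trues-replicate zero    false = refl
trues-replicate (suc k) true  = cong suc (trues-replicate k true)
trues-replicate (suc k) false = trues-replicate k false

∣∣≡trues : ∀ {n} (A : Subset n) → ∣ A ∣ ≡ trues (L.tabulate (lookup A))
∣∣≡trues V.[]           = refl
∣∣≡trues (true V.∷ A)  = cong suc (∣∣≡trues A)
∣∣≡trues (false V.∷ A) = ∣∣≡trues A

word-++ : ∀ ps qs → word (ps ++ qs) ≡ word ps ++ word qs
word-++ []             qs = refl
word-++ ((a , b) ∷ ps) qs = begin
  as ++ (bs ++ word (ps ++ qs))        ≡⟨ cong (λ w → as ++ (bs ++ w)) (word-++ ps qs) ⟩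
  as ++ (bs ++ (word ps ++ word qs))   ≡⟨ cong (as ++_) (++-assoc bs (word ps) (word qs)) ⟨
  as ++ ((bs ++ word ps) ++ word qs)   ≡⟨ ++-assoc as (bs ++ word ps) (word qs) ⟨
  word ((a , b) ∷ ps) ++ word qs       ∎
  where
  open ≡-Reasoning
  as = replicate a true
  bs = replicate b false

wordLength-∷ : ∀ a b ps → wordLength ((a , b) ∷ ps) ≡ a + (b + wordLength ps)
wordLength-∷ a b ps = trans (length-++ (replicate a true))
  (cong₂ _+_ (length-replicate a) (trans (length-++ (replicate b false)) (cong (_+ wordLength ps) (length-replicate b))))

wordLength-++ : ∀ ps qs → wordLength (ps ++ qs) ≡ wordLength ps + wordLength qs
wordLength-++ ps qs = trans (cong length (word-++ ps qs)) (length-++ (word ps))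

wordLength≡totals : ∀ ps → wordLength ps ≡ blockTotal ps + gapTotal ps
wordLength≡totals []             = refl
wordLength≡totals ((a , b) ∷ ps) =
  trans (wordLength-∷ a b ps) (trans (cong (λ z → a + (b + z)) (wordLength≡totals ps)) (interchange a b (blockTotal ps) (gapTotal ps)))
  where
  interchange : ∀ a b x y → a + (b + (x + y)) ≡ a + x + (b + y)
  interchange = solve-∀

trues-word : ∀ ps → trues (word ps) ≡ blockTotal ps
trues-word []             = refl
trues-word ((a , b) ∷ ps) = begin
  trues (as ++ (bs ++ word ps))          ≡⟨ trues-++ as (bs ++ word ps) ⟩
  trues as + trues (bs ++ word ps)       ≡⟨ cong₂ _+_ (trues-replicate a true) (trues-++ bs (word ps)) ⟩
  a + (trues bs + trues (word ps))       ≡⟨ cong₂ (λ x y → a + (x + y)) (trues-replicate b false) (trues-word ps) ⟩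
  a + blockTotal ps                      ∎
  where
  open ≡-Reasoning
  as = replicate a true
  bs = replicate b false

blockTotal-++ : ∀ ps qs → blockTotal (ps ++ qs) ≡ blockTotal ps + blockTotal qs
blockTotal-++ ps qs = trans (cong sum (map-++ proj₁ ps qs)) (sum-++ (map proj₁ ps) (map proj₁ qs))

blockTotal-swap : ∀ ps qs → blockTotal (ps ++ qs) ≡ blockTotal (qs ++ ps)
blockTotal-swap ps qs = trans (blockTotal-++ ps qs) (trans (+-comm (blockTotal ps) (blockTotal qs)) (sym (blockTotal-++ qs ps)))

wordLength-swap : ∀ ps qs → wordLength (ps ++ qs) ≡ wordLength (qs ++ ps)
wordLength-swap ps qs = trans (wordLength-++ ps qs) (trans (+-comm (wordLength ps) (wordLength qs)) (sym (wordLength-++ qs ps)))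

positive-swap : ∀ ps qs → LA.All Positive (ps ++ qs) → LA.All Positive (qs ++ ps)
positive-swap ps qs pos = LAP.++⁺ (LAP.++⁻ʳ ps pos) (LAP.++⁻ˡ ps pos)

-- Prepending true either opens a new block of length 1 or lengthens the first block.
word-decomposition : ∀ w → Σ ℕ λ c → Σ (List (ℕ × ℕ)) λ ps →
                     LA.All Positive ps × w L.∷ʳ false ≡ replicate c false ++ word ps
word-decomposition [] = 1 , [] , LA.[] , refl
word-decomposition (false ∷ w) with word-decomposition w
... | c , ps , pos , eq = suc c , ps , pos , cong (false ∷_) eq
word-decomposition (true ∷ w) with word-decomposition w
... | suc c , ps , pos , eq =
  0 , (1 , suc c) ∷ ps , (s≤s z≤n , s≤s z≤n) LA.∷ pos , cong (true ∷_) eq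
... | zero , (a , b) ∷ ps , (_ , 1≤b) LA.∷ pos , eq =
  0 , (suc a , b) ∷ ps , (s≤s z≤n , 1≤b) LA.∷ pos , cong (true ∷_) eq
... | zero , [] , _ , eq = contradiction eq (∷ʳ≢[] w false)
  where
  ∷ʳ≢[] : ∀ {A : Set} (xs : List A) x → xs L.∷ʳ x ≢ []
  ∷ʳ≢[] []       x ()
  ∷ʳ≢[] (_ ∷ xs) x ()

wordAt : List (ℕ × ℕ) → ℕ → Bool
wordAt ps = lookupOr false (word ps)

wordAt-block : ∀ a b ps j → j < a → wordAt ((a , b) ∷ ps) j ≡ true
wordAt-block a b ps j j<a =
  trans (lookupOr-++ˡ false (replicate a true) _ j (subst (j <_) (sym (length-replicate a)) j<a))
        (lookupOr-replicate false true a j j<a)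

skip-replicate : ∀ a (x : Bool) w j → lookupOr false (replicate a x ++ w) (a + j) ≡ lookupOr false w j
skip-replicate a x w j =
  trans (cong (λ k → lookupOr false (replicate a x ++ w) (k + j)) (sym (length-replicate a))) (lookupOr-++ʳ false (replicate a x) w j)

wordAt-gap : ∀ a b ps j → j < b → wordAt ((a , b) ∷ ps) (a + j) ≡ false
wordAt-gap a b ps j j<b = trans (skip-replicate a true _ j)
  (trans (lookupOr-++ˡ false (replicate b false) (word ps) j (subst (j <_) (sym (length-replicate b)) j<b))
         (lookupOr-replicate false false b j j<b))

wordAt-rest : ∀ a b ps j → wordAt ((a , b) ∷ ps) (a + (b + j)) ≡ wordAt ps j
wordAt-rest a b ps j = trans (skip-replicate a true _ (b + j)) (skip-replicate b false (word ps) j)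

wordAt-last : ∀ ps → LA.All Positive ps → ∀ k → wordLength ps ≡ suc k → wordAt ps k ≡ false
wordAt-last ((a , b) ∷ ps) (_ LA.∷ pos) k len with wordLength ps in eq
wordAt-last ((a , suc b) ∷ ps) (_ LA.∷ pos) k len | zero =
  trans (cong (wordAt ((a , suc b) ∷ ps)) k≡a+b) (wordAt-gap a (suc b) ps b ≤-refl)
  where
  k≡a+b : k ≡ a + b
  k≡a+b = suc-injective (trans (sym len) (trans (wordLength-∷ a (suc b) ps)
            (trans (cong (λ z → a + (suc b + z)) eq) (trans (cong (a +_) (+-identityʳ (suc b))) (+-suc a b)))))
wordAt-last ((a , b) ∷ ps) (_ LA.∷ pos) k len | suc k′ =
  trans (cong (wordAt ((a , b) ∷ ps)) k≡) (trans (wordAt-rest a b ps k′) (wordAt-last ps pos k′ eq))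
  where
  k≡ : k ≡ a + (b + k′)
  k≡ = suc-injective (trans (sym len) (trans (wordLength-∷ a b ps)
         (trans (cong (λ z → a + (b + z)) eq) (trans (cong (a +_) (+-suc b k′)) (+-suc a (b + k′))))))

Reads : (ℕ → Bool) → ℕ → List (ℕ × ℕ) → Set
Reads P o ps = ∀ j → j < wordLength ps → P (o + j) ≡ wordAt ps j

reads-∷ : ∀ P o a b ps → Reads P o ((a , b) ∷ ps) →
          (∀ j → j < a → P (o + j) ≡ true) × (∀ j → j < b → P (o + a + j) ≡ false) × Reads P (o + a + b) ps
reads-∷ P o a b ps reads = inBlock , inGap , inRest
  where
  reads′ : ∀ j → j < a + (b + wordLength ps) → P (o + j) ≡ wordAt ((a , b) ∷ ps) j
  reads′ j j<ℓ = reads j (subst (j <_) (sym (wordLength-∷ a b ps)) j<ℓ)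
  inBlock : ∀ j → j < a → P (o + j) ≡ true
  inBlock j j<a = trans (reads′ j (≤-trans j<a (m≤m+n a _))) (wordAt-block a b ps j j<a)
  inGap : ∀ j → j < b → P (o + a + j) ≡ false
  inGap j j<b = trans (cong P (+-assoc o a j))
    (trans (reads′ (a + j) (+-monoʳ-< a (≤-trans j<b (m≤m+n b _)))) (wordAt-gap a b ps j j<b))
  inRest : Reads P (o + a + b) ps
  inRest j j<ℓ = trans (cong P (assoc₃ o a b j))
    (trans (reads′ (a + (b + j)) (+-monoʳ-< a (+-monoʳ-< b j<ℓ))) (wordAt-rest a b ps j))
    where
    assoc₃ : ∀ o a b j → o + a + b + j ≡ o + (a + (b + j))
    assoc₃ = solve-∀

reads-start : ∀ P o ps → LA.All Positive ps → Reads P o ps → P (o + wordLength ps) ≡ true → P o ≡ true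
reads-start P o []                 _                  _     end = trans (cong P (sym (+-identityʳ o))) end
reads-start P o ((zero , b) ∷ ps)  ((() , _) LA.∷ _) _     _
reads-start P o ((suc a , b) ∷ ps) _                  reads _   = trans (cong P (sym (+-identityʳ o))) (reads 0 z<s)

run : (ℕ → Bool) → ℕ → ℕ → ℕ
run P i zero       = 0
run P i (suc fuel) = if P i then suc (run P (suc i) fuel) else 0

run-cong : ∀ (P Q : ℕ → Bool) i i′ fuel → (∀ j → P (i + j) ≡ Q (i′ + j)) → run P i fuel ≡ run Q i′ fuel
run-cong P Q i i′ zero       eq = refl
run-cong P Q i i′ (suc fuel) eq =
  trans (if-cong _ 0 (trans (cong P (sym (+-identityʳ i))) (trans (eq 0) (cong Q (+-identityʳ i′)))))
        (cong (λ z → if Q i′ then suc z else 0)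
              (run-cong P Q (suc i) (suc i′) fuel (λ j → trans (cong P (sym (+-suc i j))) (trans (eq (suc j)) (cong Q (+-suc i′ j))))))

run-exact : ∀ (P : ℕ → Bool) o a fuel → (∀ j → j < a → P (o + j) ≡ true) → P (o + a) ≡ false → a < fuel →
            run P o fuel ≡ a
run-exact P o zero    (suc fuel) _    stop _         = if-cong _ 0 (trans (cong P (sym (+-identityʳ o))) stop)
run-exact P o (suc a) (suc fuel) body stop (s≤s a<f) =
  trans (if-cong _ 0 (trans (cong P (sym (+-identityʳ o))) (body 0 z<s)))
        (cong suc (run-exact P (suc o) a fuel (λ j j<a → trans (cong P (sym (+-suc o j))) (body (suc j) (s<s j<a)))
                                             (trans (cong P (sym (+-suc o a))) stop) a<f))

-- Blocks of a periodic predicate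

module Cyclic (m : ℕ) where

  N : ℕ
  N = suc m

  IsPeriodic : (ℕ → Bool) → Set
  IsPeriodic P = ∀ j → P (j + N) ≡ P j

  -- For an N-periodic P, the index i + m stands for i - 1.
  startsBlock : (ℕ → Bool) → ℕ → Bool
  startsBlock P i = P i ∧ not (P (i + m))

  blockAt : (ℕ → Bool) → ℕ → ℕ × ℕ
  blockAt P i = run P i N , run (not ∘ P) (i + run P i N) N

  blocksFrom : (ℕ → Bool) → ℕ → ℕ → List (ℕ × ℕ)
  blocksFrom P o ℓ = map (blockAt P) (filterᵇ (startsBlock P) (range o ℓ))

  blocks : (ℕ → Bool) → List (ℕ × ℕ)
  blocks P = blocksFrom P 0 N

  count : (ℕ → Bool) → ℕ
  count P = trues (map P (range 0 N))

  Shifted : (ℕ → Bool) → (ℕ → Bool) → ℕ → Set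
  Shifted Q P u = ∀ j → Q j ≡ P (j + u)

  startsBlock-shift : ∀ P Q u → Shifted Q P u → ∀ j → startsBlock Q j ≡ startsBlock P (j + u)
  startsBlock-shift P Q u sh j = cong₂ _∧_ (sh j) (cong not (trans (sh (j + m)) (cong P (swap j m u))))
    where
    swap : ∀ j m u → j + m + u ≡ j + u + m
    swap = solve-∀

  blockAt-shift : ∀ P Q u → Shifted Q P u → ∀ j → blockAt Q j ≡ blockAt P (j + u)
  blockAt-shift P Q u sh j = cong₂ _,_ block gap
    where
    swap : ∀ j i u → j + i + u ≡ j + u + i
    swap = solve-∀
    block : run Q j N ≡ run P (j + u) N
    block = run-cong Q P j (j + u) N (λ i → trans (sh (j + i)) (cong P (swap j i u)))
    gap : run (not ∘ Q) (j + run Q j N) N ≡ run (not ∘ P) (j + u + run P (j + u) N) N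
    gap = trans (cong (λ z → run (not ∘ Q) (j + z) N) block)
      (run-cong (not ∘ Q) (not ∘ P) _ _ N (λ i → cong not (trans (sh _) (cong P (swap₂ j (run P (j + u) N) i u)))))
      where
      swap₂ : ∀ j r i u → j + r + i + u ≡ j + u + r + i
      swap₂ = solve-∀

  blockList : (ℕ → Bool) → ℕ → List (ℕ × ℕ)
  blockList P i = if startsBlock P i then blockAt P i ∷ [] else []

  -- Shifting a periodic predicate by u cuts its list of blocks at the
  -- first block starting at or after u and swaps the two parts.
  blocks-shift : ∀ P Q u → IsPeriodic P → Shifted Q P u → u ≤ N →
                 Σ (List (ℕ × ℕ)) λ X → Σ (List (ℕ × ℕ)) λ Y → blocks P ≡ X ++ Y × blocks Q ≡ Y ++ X
  blocks-shift P Q u per sh u≤N =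
    concatMap (blockList P) (range 0 u) , concatMap (blockList P) (range u (N ∸ u)) ,
    trans (map-filterᵇ≡concatMap (startsBlock P) (blockAt P) (range 0 N)) (proj₁ parts) ,
    trans (map-filterᵇ≡concatMap (startsBlock Q) (blockAt Q) (range 0 N)) (proj₂ parts)
    where
    blockList-shift : ∀ P Q u → Shifted Q P u → ∀ j → blockList Q j ≡ blockList P (j + u)
    blockList-shift P Q u sh j =
      cong₂ (λ s x → if s then x ∷ [] else []) (startsBlock-shift P Q u sh j) (blockAt-shift P Q u sh j)
    parts = concatMap-range-rotate N u (blockList P) (blockList Q) u≤N
              (λ j → sym (blockList-shift P P N (sym ∘ per) j)) (blockList-shift P Q u sh)

  count-shift : ∀ P Q u → IsPeriodic P → Shifted Q P u → u ≤ N → count Q ≡ count P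
  count-shift P Q u per sh u≤N = begin
    trues (map Q (range 0 N))  ≡⟨ cong trues (trans (map≡concatMap Q (range 0 N)) (proj₂ parts)) ⟩
    trues (Y ++ X)             ≡⟨ trues-++ Y X ⟩
    trues Y + trues X          ≡⟨ +-comm (trues Y) (trues X) ⟩
    trues X + trues Y          ≡⟨ trues-++ X Y ⟨
    trues (X ++ Y)             ≡⟨ cong trues (trans (map≡concatMap P (range 0 N)) (proj₁ parts)) ⟨
    trues (map P (range 0 N))  ∎
    where
    open ≡-Reasoning
    parts = concatMap-range-rotate N u (L.[_] ∘ P) (L.[_] ∘ Q) u≤N (cong L.[_] ∘ per) (cong L.[_] ∘ sh)
    X = concatMap (L.[_] ∘ P) (range 0 u)
    Y = concatMap (L.[_] ∘ P) (range u (N ∸ u))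

  blocksFrom-++ : ∀ P o p q → blocksFrom P o (p + q) ≡ blocksFrom P o p ++ blocksFrom P (o + p) q
  blocksFrom-++ P o p q = begin
    map (blockAt P) (filterᵇ (startsBlock P) (range o (p + q)))
      ≡⟨ cong (map (blockAt P) ∘ filterᵇ (startsBlock P)) (range-++ o p q) ⟩
    map (blockAt P) (filterᵇ (startsBlock P) (range o p ++ range (o + p) q))
      ≡⟨ cong (map (blockAt P)) (filter-++ (T? ∘ startsBlock P) (range o p) (range (o + p) q)) ⟩
    map (blockAt P) (filterᵇ (startsBlock P) (range o p) ++ filterᵇ (startsBlock P) (range (o + p) q))
      ≡⟨ map-++ (blockAt P) (filterᵇ (startsBlock P) (range o p)) _ ⟩
    blocksFrom P o p ++ blocksFrom P (o + p) q ∎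
    where open ≡-Reasoning

  blocksFrom-none : ∀ P o ℓ → (∀ j → j < ℓ → startsBlock P (o + j) ≡ false) → blocksFrom P o ℓ ≡ []
  blocksFrom-none P o ℓ none = cong (map (blockAt P)) (filterᵇ-range-none (startsBlock P) o ℓ none)

  module _ (P : ℕ → Bool) (per : IsPeriodic P) where

    previous : ∀ i → P (suc i + m) ≡ P i
    previous i = trans (cong P (sym (+-suc i m))) (per i)

    blocksFrom-block : ∀ o a b → suc a < N → suc b < N →
      (∀ j → j < suc a → P (o + j) ≡ true) → (∀ j → j < suc b → P (o + suc a + j) ≡ false) →
      P (o + suc a + suc b) ≡ true → P (o + m) ≡ false → blocksFrom P o (suc a) ≡ (suc a , suc b) ∷ []
    blocksFrom-block o a b a<N b<N inBlock inGap afterGap before = begin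
      map (blockAt P) (filterᵇ (startsBlock P) (o ∷ range (suc o) a))
        ≡⟨ cong (map (blockAt P)) (filterᵇ-accept (startsBlock P) o _ starts) ⟩
      blockAt P o ∷ blocksFrom P (suc o) a
        ≡⟨ cong₂ _∷_ (cong₂ _,_ blockRun gapRun) (blocksFrom-none P (suc o) a noStart) ⟩
      (suc a , suc b) ∷ [] ∎
      where
      open ≡-Reasoning
      starts : startsBlock P o ≡ true
      starts = cong₂ _∧_ (trans (cong P (sym (+-identityʳ o))) (inBlock 0 z<s)) (cong not before)
      noStart : ∀ j → j < a → startsBlock P (suc o + j) ≡ false
      noStart j j<a = trans (cong (λ x → P (suc o + j) ∧ not x) (previous (o + j))) 
        (trans (cong (λ x → P (suc o + j) ∧ not x) (inBlock j (m<n⇒m<1+n j<a))) (∧-zeroʳ _))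
      blockRun : run P o N ≡ suc a
      blockRun = run-exact P o (suc a) N inBlock (trans (cong P (sym (+-identityʳ _))) (inGap 0 z<s)) a<N
      gapRun : run (not ∘ P) (o + run P o N) N ≡ suc b
      gapRun = trans (cong (λ r → run (not ∘ P) (o + r) N) blockRun)
                     (run-exact (not ∘ P) (o + suc a) (suc b) N (λ j j<b → cong not (inGap j j<b)) (cong not afterGap) b<N)

    blocksFrom-word : ∀ qs o → LA.All Positive qs → Reads P o qs →
      P (o + wordLength qs) ≡ true → P (o + m) ≡ false → wordLength qs ≤ N → blocksFrom P o (wordLength qs) ≡ qs
    blocksFrom-word [] _ _ _ _ _ _ = refl
    blocksFrom-word ((suc a , suc b) ∷ rest) o (_ LA.∷ posRest) reads next before len≤N = begin
      blocksFrom P o (wordLength ((A , B) ∷ rest))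
        ≡⟨ cong (blocksFrom P o) (wordLength-∷ A B rest) ⟩
      blocksFrom P o (A + (B + T))
        ≡⟨ blocksFrom-++ P o A (B + T) ⟩
      blocksFrom P o A ++ blocksFrom P (o + A) (B + T)
        ≡⟨ cong (blocksFrom P o A ++_) (blocksFrom-++ P (o + A) B T) ⟩
      blocksFrom P o A ++ (blocksFrom P (o + A) B ++ blocksFrom P (o + A + B) T)
        ≡⟨ cong₂ _++_ first (cong₂ _++_ (blocksFrom-none P (o + A) B gapNoStart) tail) ⟩
      (A , B) ∷ rest ∎
      where
      open ≡-Reasoning
      A = suc a
      B = suc b
      T = wordLength rest
      parts = reads-∷ P o A B rest reads
      inBlock = proj₁ parts
      inGap = proj₁ (proj₂ parts)
      inRest = proj₂ (proj₂ parts)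
      A+B≤N : A + B ≤ N
      A+B≤N = ≤-trans (+-monoʳ-≤ A (m≤m+n B T)) (subst (_≤ N) (wordLength-∷ A B rest) len≤N)
      afterRest : P (o + A + B + T) ≡ true
      afterRest = trans (cong P (trans (assoc₃ o A B T) (cong (o +_) (sym (wordLength-∷ A B rest))))) next
        where
        assoc₃ : ∀ o a b t → o + a + b + t ≡ o + (a + (b + t))
        assoc₃ = solve-∀
      gapNoStart : ∀ j → j < B → startsBlock P (o + A + j) ≡ false
      gapNoStart j j<B = cong (_∧ not (P (o + A + j + m))) (inGap j j<B)
      first : blocksFrom P o A ≡ (A , B) ∷ []
      first = blocksFrom-block o a b (<-≤-trans (m<m+n A z<s) A+B≤N) (<-≤-trans (m<n+m B z<s) A+B≤N)
                inBlock inGap (reads-start P (o + A + B) rest posRest inRest afterRest) before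
      tail : blocksFrom P (o + A + B) T ≡ rest
      tail = blocksFrom-word rest (o + A + B) posRest inRest afterRest
               (trans (cong (λ i → P (i + m)) (+-suc (o + A) b)) (trans (previous (o + A + b)) (inGap b ≤-refl)))
               (≤-trans (≤-trans (m≤n+m T B) (m≤n+m (B + T) A)) (subst (_≤ N) (wordLength-∷ A B rest) len≤N))

    blocks-word : ∀ ps → LA.All Positive ps → wordLength ps ≡ N →
                  (∀ j → j < N → P j ≡ wordAt ps j) → blocks P ≡ ps
    blocks-word ((zero , _) ∷ _) ((() , _) LA.∷ _) _ _
    blocks-word ps@((suc a , b) ∷ _) pos len agree =
      trans (cong (blocksFrom P 0) (sym len))
            (blocksFrom-word ps 0 pos (λ j j<ℓ → agree j (subst (j <_) len j<ℓ))
               (trans (cong P len) (trans (per 0) (agree 0 z<s)))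
               (trans (agree m ≤-refl) (wordAt-last ps pos m len))
               (≤-reflexive len))

  count-word : ∀ P ps → wordLength ps ≡ N → (∀ j → j < N → P j ≡ wordAt ps j) → count P ≡ blockTotal ps
  count-word P ps len agree = begin
    trues (map P (range 0 N))                                ≡⟨ cong trues (map-cong-range P (wordAt ps) 0 N agree) ⟩
    trues (map (wordAt ps) (range 0 N))                      ≡⟨ cong (λ ℓ → trues (map (wordAt ps) (range 0 ℓ))) len ⟨
    trues (map (wordAt ps) (range 0 (wordLength ps)))        ≡⟨ cong trues (map-lookupOr-range false (word ps)) ⟩
    trues (word ps)                                          ≡⟨ trues-word ps ⟩
    blockTotal ps                                            ∎
    where open ≡-Reasoning

  -- Subsets of ℤ_N as periodic predicates

  member : Subset N → ℕ → Bool
  member A i = lookup A (i mod N)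

  toℕ-mod : ∀ i → toℕ (i mod N) ≡ i % N
  toℕ-mod i = FP.toℕ-fromℕ< (m%n<n i N)

  member-% : ∀ A i j → i % N ≡ j % N → member A i ≡ member A j
  member-% A i j eq = cong (lookup A) (FP.toℕ-injective (trans (toℕ-mod i) (trans eq (sym (toℕ-mod j)))))

  member-toℕ : ∀ A (y : Fin N) → member A (toℕ y) ≡ lookup A y
  member-toℕ A y = cong (lookup A) (FP.toℕ-injective (trans (toℕ-mod (toℕ y)) (m<n⇒m%n≡m (FP.toℕ<n y))))

  member-periodic : ∀ A → IsPeriodic (member A)
  member-periodic A j = member-% A (j + N) j ([m+n]%n≡m%n j N)

  member-+% : ∀ A j t → member A (j + t % N) ≡ member A (j + t)
  member-+% A j t = member-% A (j + t % N) (j + t) (%-+ʳ N j t)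

  member-%+ : ∀ A j t → member A (j % N + t) ≡ member A (j + t)
  member-%+ A j t = member-% A (j % N + t) (j + t) (%-+ˡ N j t)

  member-injective : ∀ A B → (∀ j → member A j ≡ member B j) → A ≡ B
  member-injective A B eq = Vec-ext A B (λ y → trans (sym (member-toℕ A y)) (trans (eq (toℕ y)) (member-toℕ B y)))

  Translate : Subset N → Subset N → ℕ → Set
  Translate A B t = Shifted (member B) (member A) t

  translate-trans : ∀ A B C t u → Translate A B t → Translate B C u → Translate A C (u + t)
  translate-trans A B C t u AB BC j = trans (BC j) (trans (AB (j + u)) (cong (member A) (+-assoc j u t)))

  -- Translating back by t is translating forward by m * t ≡ - t (mod N).
  translate-sym : ∀ A B t → Translate A B t → Translate B A (m * t)
  translate-sym A B t AB j =
    trans (sym (member-% A (j + t * N) j ([m+kn]%n≡m%n j t N)))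
          (trans (cong (member A) (sym (regroup j m t))) (sym (AB (j + m * t))))
    where
    regroup : ∀ j m t → j + m * t + t ≡ j + t * suc m
    regroup = solve-∀

  shift⇒translate : ∀ A B s → shift A s ≡ B → Translate A B (N ∸ toℕ s)
  shift⇒translate A B s refl j =
    trans (VP.lookup∘tabulate (λ y → lookup A (addMod y (N ∸ toℕ s))) (j mod N))
          (trans (cong (λ z → member A (z + (N ∸ toℕ s))) (toℕ-mod j)) (member-%+ A j (N ∸ toℕ s)))

  private
    negate-negate : ∀ t → (N ∸ toℕ ((N ∸ t % N) mod N)) % N ≡ t % N
    negate-negate t with t % N in eq
    ... | zero  = trans (cong (λ z → (N ∸ z) % N) (trans (toℕ-mod N) (n%n≡0 N))) (n%n≡0 N)
    ... | suc x = trans (cong (λ z → (N ∸ z) % N) (trans (toℕ-mod (N ∸ suc x)) (m<n⇒m%n≡m (s≤s (m∸n≤m m x)))))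
                        (trans (cong (_% N) (m∸[m∸n]≡n x<N)) (trans (cong (_% N) (sym eq)) (trans (m%n%n≡m%n t N) eq)))
      where
      x<N : suc x ≤ N
      x<N = subst (_≤ N) eq (<⇒≤ (m%n<n t N))

  translate⇒shift : ∀ A B t → Translate A B t → Σ (Fin N) λ s → shift A s ≡ B
  translate⇒shift A B t AB = s , member-injective (shift A s) B (λ j → begin
      member (shift A s) j             ≡⟨ shift⇒translate A (shift A s) s refl j ⟩
      member A (j + (N ∸ toℕ s))       ≡⟨ member-+% A j (N ∸ toℕ s) ⟨
      member A (j + (N ∸ toℕ s) % N)   ≡⟨ cong (λ z → member A (j + z)) (negate-negate t) ⟩
      member A (j + t % N)             ≡⟨ member-+% A j t ⟩
      member A (j + t)                 ≡⟨ AB j ⟨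
      member B j                       ∎)
    where
    open ≡-Reasoning
    s = (N ∸ t % N) mod N

  runLength≡run : ∀ A d fuel → runLength A d fuel ≡ run (member A) (toℕ d) fuel
  runLength≡run A d zero       = refl
  runLength≡run A d (suc fuel) =
    trans (if-cong _ 0 (sym (member-toℕ A d)))
          (cong (λ z → if member A (toℕ d) then suc z else 0) (trans (runLength≡run A (addMod d 1) fuel) next))
    where
    next : run (member A) (toℕ (addMod d 1)) fuel ≡ run (member A) (suc (toℕ d)) fuel
    next = run-cong (member A) (member A) _ _ fuel (λ i →
      trans (cong (λ z → member A (z + i)) (toℕ-mod (toℕ d + 1)))
            (trans (member-%+ A (toℕ d + 1) i) (cong (λ z → member A (z + i)) (+-comm (toℕ d) 1))))

  blockComposition≡blocks : ∀ A → blockComposition A ≡ map proj₁ (blocks (member A))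
  blockComposition≡blocks A = begin
    map (λ d → runLength A d N) (filterᵇ (isBlockStart A) (allFin N))
      ≡⟨ map-cong (λ d → runLength≡run A d N) _ ⟩
    map (λ d → run (member A) (toℕ d) N) (filterᵇ (isBlockStart A) (allFin N))
      ≡⟨ cong (map (λ d → run (member A) (toℕ d) N))
              (filterᵇ-cong (λ d → cong (_∧ not (member A (toℕ d + m))) (sym (member-toℕ A d))) (allFin N)) ⟩
    map (λ d → run (member A) (toℕ d) N) (filterᵇ (startsBlock (member A) ∘ toℕ) (allFin N))
      ≡⟨ map-filterᵇ-map toℕ (startsBlock (member A)) (λ i → run (member A) i N) (allFin N) ⟨
    map (λ i → run (member A) i N) (filterᵇ (startsBlock (member A)) (map toℕ (allFin N)))
      ≡⟨ cong (λ is → map (λ i → run (member A) i N) (filterᵇ (startsBlock (member A)) is)) (map-toℕ-allFin N) ⟩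
    map (λ i → run (member A) i N) (filterᵇ (startsBlock (member A)) (range 0 N))
      ≡⟨ map-∘ (filterᵇ (startsBlock (member A)) (range 0 N)) ⟩
    map proj₁ (blocks (member A)) ∎
    where open ≡-Reasoning

  ∣∣≡count : ∀ A → ∣ A ∣ ≡ count (member A)
  ∣∣≡count A = begin
    ∣ A ∣                                        ≡⟨ ∣∣≡trues A ⟩
    trues (L.tabulate {n = N} (lookup A))        ≡⟨ cong trues (tabulate-cong {n = N} (λ y → sym (member-toℕ A y))) ⟩
    trues (L.tabulate {n = N} (member A ∘ toℕ))  ≡⟨ cong trues (map-tabulate {n = N} (λ i → i) (member A ∘ toℕ)) ⟨
    trues (map (member A ∘ toℕ) (allFin N))      ≡⟨ cong trues (map-∘ {g = member A} {f = toℕ} (allFin N)) ⟩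
    trues (map (member A) (map toℕ (allFin N)))  ≡⟨ cong (trues ∘ map (member A)) (map-toℕ-allFin N) ⟩
    count (member A)                             ∎
    where open ≡-Reasoning

  wordSubset : List (ℕ × ℕ) → Subset N
  wordSubset ps = toVecOr false N (word ps)

  member-wordSubset : ∀ ps j → member (wordSubset ps) j ≡ wordAt ps (j % N)
  member-wordSubset ps j = trans (lookup-toVecOr false N (word ps) (j mod N)) (cong (wordAt ps) (toℕ-mod j))

  member-wordSubset-< : ∀ ps j → j < N → member (wordSubset ps) j ≡ wordAt ps j
  member-wordSubset-< ps j j<N = trans (member-wordSubset ps j) (cong (wordAt ps) (m<n⇒m%n≡m j<N))

  wordSubset-rotate : ∀ ps qs → wordLength ps + wordLength qs ≡ N →
                      Translate (wordSubset (ps ++ qs)) (wordSubset (qs ++ ps)) (wordLength ps)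
  wordSubset-rotate ps qs len j = begin
    member (wordSubset (qs ++ ps)) j                             ≡⟨ member-wordSubset (qs ++ ps) j ⟩
    lookupOr false (word (qs ++ ps)) (j % N)                     ≡⟨ cong (λ w → lookupOr false w (j % N)) (word-++ qs ps) ⟩
    lookupOr false (word qs ++ word ps) (j % N)                  ≡⟨ lookupOr-rotate false N (word ps) (word qs) len (j % N) (m%n<n j N) ⟩
    lookupOr false (word ps ++ word qs) ((j % N + wordLength ps) % N)
                                                                 ≡⟨ cong (lookupOr false (word ps ++ word qs)) (%-+ˡ N j (wordLength ps)) ⟩
    lookupOr false (word ps ++ word qs) ((j + wordLength ps) % N) ≡⟨ cong (λ w → lookupOr false w ((j + wordLength ps) % N)) (word-++ ps qs) ⟨
    wordAt (ps ++ qs) ((j + wordLength ps) % N)                  ≡⟨ member-wordSubset (ps ++ qs) (j + wordLength ps) ⟨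
    member (wordSubset (ps ++ qs)) (j + wordLength ps)           ∎
    where open ≡-Reasoning

  word-at-blockStart : ∀ P d → startsBlock P d ≡ true →
    Σ (List (ℕ × ℕ)) λ ps → LA.All Positive ps × map (λ j → P (d + j)) (range 0 N) ≡ word ps
  word-at-blockStart P d starts = fromDecomposition (word-decomposition (map read (range 0 m)))
    where
    read : ℕ → Bool
    read j = P (d + j)
    first : P d ≡ true
    first = proj₁ (∧-true (P d) (not (P (d + m))) starts)
    readAll : map read (range 0 N) ≡ map read (range 0 m) L.∷ʳ false
    readAll = trans (map-range-∷ʳ read m) (cong (map read (range 0 m) L.∷ʳ_) (not-true _ (proj₂ (∧-true (P d) _ starts))))
    fromDecomposition : (Σ ℕ λ c → Σ (List (ℕ × ℕ)) λ ps →
                           LA.All Positive ps × map read (range 0 m) L.∷ʳ false ≡ replicate c false ++ word ps) →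
                        Σ (List (ℕ × ℕ)) λ ps → LA.All Positive ps × map read (range 0 N) ≡ word ps
    fromDecomposition (zero , ps , pos , eq) = ps , pos , trans readAll eq
    fromDecomposition (suc c , ps , pos , eq) = contradiction (trans (sym first) (trans (cong P (sym (+-identityʳ d))) firstRead)) λ ()
      where
      firstRead : read 0 ≡ false
      firstRead = trans (sym (lookupOr-map-range false read 0 N 0 z<s)) (cong (λ w → lookupOr false w 0) (trans readAll eq))

  wordSubset-from-blockStart : ∀ A d → startsBlock (member A) d ≡ true →
    Σ (List (ℕ × ℕ)) λ ps → LA.All Positive ps × wordLength ps ≡ N × Translate A (wordSubset ps) d
  wordSubset-from-blockStart A d starts = ps , pos , len , translate
    where
    open ≡-Reasoning
    read = word-at-blockStart (member A) d starts
    ps = proj₁ read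
    pos = proj₁ (proj₂ read)
    readEq : map (λ j → member A (d + j)) (range 0 N) ≡ word ps
    readEq = proj₂ (proj₂ read)
    len : wordLength ps ≡ N
    len = trans (cong length (sym readEq)) (trans (length-map _ (range 0 N)) (length-range 0 N))
    translate : Translate A (wordSubset ps) d
    translate j = begin
      member (wordSubset ps) j                          ≡⟨ member-wordSubset ps j ⟩
      lookupOr false (word ps) (j % N)                  ≡⟨ cong (λ w → lookupOr false w (j % N)) readEq ⟨
      lookupOr false (map (λ i → member A (d + i)) (range 0 N)) (j % N)
                                                        ≡⟨ lookupOr-map-range false (λ i → member A (d + i)) 0 N (j % N) (m%n<n j N) ⟩
      member A (d + j % N)                              ≡⟨ cong (member A) (+-comm d (j % N)) ⟩
      member A (j % N + d)                              ≡⟨ member-%+ A j d ⟩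
      member A (j + d)                                  ∎

  blocks-translate-wordSubset : ∀ A ps d → LA.All Positive ps → wordLength ps ≡ N → Translate A (wordSubset ps) d →
    Σ (List (ℕ × ℕ)) λ X → Σ (List (ℕ × ℕ)) λ Y → blocks (member A) ≡ X ++ Y × ps ≡ Y ++ X × blockTotal ps ≡ ∣ A ∣
  blocks-translate-wordSubset A ps d pos len translate = X , Y , proj₁ (proj₂ (proj₂ rotation)) , ps≡YX , total
    where
    Q = member (wordSubset ps)
    u = d % N
    u≤N : u ≤ N
    u≤N = <⇒≤ (m%n<n d N)
    shifted : Shifted Q (member A) u
    shifted j = trans (translate j) (sym (member-+% A j d))
    rotation = blocks-shift (member A) Q u (member-periodic A) shifted u≤N
    X = proj₁ rotation
    Y = proj₁ (proj₂ rotation)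
    ps≡YX : ps ≡ Y ++ X
    ps≡YX = trans (sym (blocks-word Q (member-periodic (wordSubset ps)) ps pos len (member-wordSubset-< ps)))
                  (proj₂ (proj₂ (proj₂ rotation)))
    total : blockTotal ps ≡ ∣ A ∣
    total = trans (sym (count-word Q ps len (member-wordSubset-< ps)))
                  (trans (count-shift (member A) Q u (member-periodic A) shifted u≤N) (sym (∣∣≡count A)))

  record NormalForm (A : Subset N) : Set where
    field
      positive      : LA.All Positive (blocks (member A))
      wordLength≡N  : wordLength (blocks (member A)) ≡ N
      blockTotal≡∣∣ : blockTotal (blocks (member A)) ≡ ∣ A ∣
      offset        : ℕ
      translate     : Translate A (wordSubset (blocks (member A))) offset

  -- The blocks of A, read from the block start d, form a word ps whose
  -- blocks are those of A rotated; rotating the word back is a translation.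
  normalForm : ∀ A d → startsBlock (member A) d ≡ true → NormalForm A
  normalForm A d starts with wordSubset-from-blockStart A d starts
  ... | ps , pos , len , toWord with blocks-translate-wordSubset A ps d pos len toWord
  ... | X , Y , blocksA , refl , total = record
    { positive      = subst (LA.All Positive) (sym blocksA) (positive-swap Y X pos)
    ; wordLength≡N  = trans (cong wordLength blocksA) (trans (wordLength-swap X Y) len)
    ; blockTotal≡∣∣ = trans (cong blockTotal blocksA) (trans (blockTotal-swap X Y) total)
    ; offset        = wordLength Y + d
    ; translate     = subst (λ qs → Translate A (wordSubset qs) (wordLength Y + d)) (sym blocksA)
                        (translate-trans A (wordSubset (Y ++ X)) (wordSubset (X ++ Y)) d (wordLength Y) toWord
                          (wordSubset-rotate Y X (trans (sym (wordLength-++ Y X)) len)))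
    }

  blockStart-exists : ∀ A {ℓ} → length (blockComposition A) ≡ suc ℓ → Σ ℕ λ d → startsBlock (member A) d ≡ true
  blockStart-exists A len with filterᵇ (startsBlock (member A)) (range 0 N) in starts
  ... | d ∷ _ = d , filterᵇ-head (startsBlock (member A)) (range 0 N) starts
  ... | []    = contradiction (trans (sym len) (trans (cong length (blockComposition≡blocks A)) lengthBlocks)) λ ()
    where
    lengthBlocks : length (map proj₁ (blocks (member A))) ≡ 0
    lengthBlocks = trans (length-map proj₁ (blocks (member A)))
                         (trans (length-map (blockAt (member A)) (filterᵇ (startsBlock (member A)) (range 0 N))) (cong length starts))

toVecOr-All : ∀ {A : Set} {P : A → Set} d n xs → length xs ≡ n → LA.All P xs → VA.All P (toVecOr d n xs)
toVecOr-All d zero    []       _   LA.[]         = VA.[]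
toVecOr-All d (suc n) (x ∷ xs) len (px LA.∷ pxs) = px VA.∷ toVecOr-All d n xs (suc-injective len) pxs

vsum-toVecOr : ∀ n xs → length xs ≡ n → vsum (toVecOr 0 n xs) ≡ sum xs
vsum-toVecOr zero    []       _   = refl
vsum-toVecOr (suc n) (x ∷ xs) len = cong (x +_) (vsum-toVecOr n xs (suc-injective len))

isComposition-toVecOr : ∀ r xs → length xs ≡ r → LA.All (1 ≤_) xs → IsComposition (sum xs) r (toVecOr 0 r xs)
isComposition-toVecOr r xs len pos = toVecOr-All 0 r xs len pos , vsum-toVecOr r xs len

toVecOr-injective : ∀ {A : Set} (d : A) n xs ys → length xs ≡ n → length ys ≡ n → toVecOr d n xs ≡ toVecOr d n ys → xs ≡ ys
toVecOr-injective d zero    []       []       _    _    _  = refl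
toVecOr-injective d (suc n) (x ∷ xs) (y ∷ ys) lenx leny eq =
  cong₂ _∷_ (VP.∷-injectiveˡ eq) (toVecOr-injective d n xs ys (suc-injective lenx) (suc-injective leny) (VP.∷-injectiveʳ eq))

toVecOr-toList : ∀ {A : Set} (d : A) {n} (v : Vec A n) → toVecOr d n (V.toList v) ≡ v
toVecOr-toList d V.[]       = refl
toVecOr-toList d (x V.∷ v) = cong (x V.∷_) (toVecOr-toList d v)

sum-toList : ∀ {n} (v : Vec ℕ n) → sum (V.toList v) ≡ vsum v
sum-toList V.[]       = refl
sum-toList (x V.∷ v) = cong (x +_) (sum-toList v)

positive-zip : ∀ {n} {c c′ : Vec ℕ n} → VA.All (1 ≤_) c → VA.All (1 ≤_) c′ → VA.All Positive (V.zip c c′)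
positive-zip VA.[]         VA.[]           = VA.[]
positive-zip (p VA.∷ pos) (p′ VA.∷ pos′) = (p , p′) VA.∷ positive-zip pos pos′

rotate-zero : ∀ {r} (v : Vec ℕ (suc r)) → rotate F.zero v ≡ v
rotate-zero {r} v = Vec-ext _ v (λ i → trans (VP.lookup∘tabulate (λ i → lookup v (addMod i 0)) i)
  (cong (lookup v) (FP.toℕ-injective (trans (FP.toℕ-fromℕ< (m%n<n (toℕ i + 0) (suc r)))
     (trans (cong (_% suc r) (+-identityʳ (toℕ i))) (m<n⇒m%n≡m (FP.toℕ<n i)))))))

rotate-toVecOr : ∀ r (xs ys : List ℕ) → length xs + length ys ≡ suc r →
                 rotate (length xs mod suc r) (toVecOr 0 (suc r) (xs ++ ys)) ≡ toVecOr 0 (suc r) (ys ++ xs)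
rotate-toVecOr r xs ys len = Vec-ext _ _ (λ i → begin
    lookup (rotate s v) i                                ≡⟨ VP.lookup∘tabulate (λ i → lookup v (addMod i (toℕ s))) i ⟩
    lookup v (addMod i (toℕ s))                          ≡⟨ lookup-toVecOr 0 (suc r) (xs ++ ys) (addMod i (toℕ s)) ⟩
    lookupOr 0 (xs ++ ys) (toℕ (addMod i (toℕ s)))       ≡⟨ cong (lookupOr 0 (xs ++ ys)) (index i) ⟩
    lookupOr 0 (xs ++ ys) ((toℕ i + length xs) % suc r)  ≡⟨ lookupOr-rotate 0 (suc r) xs ys len (toℕ i) (FP.toℕ<n i) ⟨
    lookupOr 0 (ys ++ xs) (toℕ i)                        ≡⟨ lookup-toVecOr 0 (suc r) (ys ++ xs) i ⟨
    lookup (toVecOr 0 (suc r) (ys ++ xs)) i              ∎)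
  where
  open ≡-Reasoning
  s = length xs mod suc r
  v = toVecOr 0 (suc r) (xs ++ ys)
  index : ∀ i → toℕ (addMod i (toℕ s)) ≡ (toℕ i + length xs) % suc r
  index i = trans (FP.toℕ-fromℕ< (m%n<n (toℕ i + toℕ s) (suc r)))
    (trans (cong (λ z → (toℕ i + z) % suc r) (FP.toℕ-fromℕ< (m%n<n (length xs) (suc r)))) (%-+ʳ (suc r) (toℕ i) (length xs)))

rotate-toVecOr-map : ∀ {A : Set} r (π : A → ℕ) xs ys → length xs + length ys ≡ suc r →
  rotate (length xs mod suc r) (toVecOr 0 (suc r) (map π (xs ++ ys))) ≡ toVecOr 0 (suc r) (map π (ys ++ xs))
rotate-toVecOr-map r π xs ys len = begin
  rotate (length xs mod suc r) (toVecOr 0 (suc r) (map π (xs ++ ys)))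
    ≡⟨ cong₂ (λ l zs → rotate (l mod suc r) (toVecOr 0 (suc r) zs)) (sym (length-map π xs)) (map-++ π xs ys) ⟩
  rotate (length (map π xs) mod suc r) (toVecOr 0 (suc r) (map π xs ++ map π ys))
    ≡⟨ rotate-toVecOr r (map π xs) (map π ys) (trans (cong₂ _+_ (length-map π xs) (length-map π ys)) len) ⟩
  toVecOr 0 (suc r) (map π ys ++ map π xs)
    ≡⟨ cong (toVecOr 0 (suc r)) (map-++ π ys xs) ⟨
  toVecOr 0 (suc r) (map π (ys ++ xs)) ∎
  where open ≡-Reasoning

rotate-toVecOr-map⁻¹ : ∀ {A : Set} r (π : A → ℕ) ps qs (j : Fin (suc r)) → length ps ≡ suc r → length qs ≡ suc r →
  rotate j (toVecOr 0 (suc r) (map π ps)) ≡ toVecOr 0 (suc r) (map π qs) →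
  map π qs ≡ map π (L.drop (toℕ j) ps ++ L.take (toℕ j) ps)
rotate-toVecOr-map⁻¹ r π ps qs j lenps lenqs rot =
  toVecOr-injective 0 (suc r) _ _ (trans (length-map π qs) lenqs)
    (trans (length-map π (Y ++ X)) (trans (length-++ Y) (trans (+-comm (length Y) (length X)) lengthXY)))
    (trans (sym rot) (trans (cong₂ (λ i zs → rotate i (toVecOr 0 (suc r) (map π zs))) (sym index) ps≡XY)
                            (rotate-toVecOr-map r π X Y lengthXY)))
  where
  X = L.take (toℕ j) ps
  Y = L.drop (toℕ j) ps
  ps≡XY : ps ≡ X ++ Y
  ps≡XY = sym (take++drop≡id (toℕ j) ps)
  lengthXY : length X + length Y ≡ suc r
  lengthXY = trans (sym (length-++ X)) (trans (cong length (sym ps≡XY)) lenps)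
  lengthX : length X ≡ toℕ j
  lengthX = trans (length-take (toℕ j) ps) (trans (cong (toℕ j ⊓_) lenps) (m≤n⇒m⊓n≡m (<⇒≤ (FP.toℕ<n j))))
  index : length X mod suc r ≡ j
  index = FP.toℕ-injective (trans (FP.toℕ-fromℕ< (m%n<n (length X) (suc r)))
                                  (trans (cong (_% suc r) lengthX) (m<n⇒m%n≡m (FP.toℕ<n j))))

module Bijection (m r k : ℕ) (k≤N : k ≤ suc m) where
  open Cyclic m

  blockVec gapVec : Subset N → Vec ℕ (suc r)
  blockVec A = toVecOr 0 (suc r) (map proj₁ (blocks (member A)))
  gapVec   A = toVecOr 0 (suc r) (map proj₂ (blocks (member A)))

  length-blocks : ∀ A → length (blockComposition A) ≡ suc r → length (blocks (member A)) ≡ suc r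
  length-blocks A len = trans (sym (length-map proj₁ (blocks (member A)))) (trans (cong length (sym (blockComposition≡blocks A))) len)

  normalForm′ : ∀ A → length (blockComposition A) ≡ suc r → NormalForm A
  normalForm′ A len = let (d , starts) = blockStart-exists A len in normalForm A d starts

  toComposition : TSet N k (suc r) → ZSet N k (suc r)
  toComposition (A , card , len) = (blockVec A , gapVec A) ,
      subst (λ t → IsComposition t (suc r) (blockVec A)) total
            (isComposition-toVecOr (suc r) (map proj₁ bs) (trans (length-map proj₁ bs) lenA) (LAP.map⁺ (LA.map proj₁ positive))) ,
      subst (λ t → IsComposition t (suc r) (gapVec A)) gaps
            (isComposition-toVecOr (suc r) (map proj₂ bs) (trans (length-map proj₂ bs) lenA) (LAP.map⁺ (LA.map proj₂ positive)))
    where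
    open NormalForm (normalForm′ A len)
    bs = blocks (member A)
    lenA = length-blocks A len
    total : blockTotal bs ≡ k
    total = trans blockTotal≡∣∣ card
    gaps : gapTotal bs ≡ N ∸ k
    gaps = trans (sym (m+n∸m≡n (blockTotal bs) (gapTotal bs)))
                 (cong₂ _∸_ (trans (sym (wordLength≡totals bs)) wordLength≡N) total)

  toComposition-respects : ∀ x y → SameShiftOrbit x y → SameRotOrbit (toComposition x) (toComposition y)
  toComposition-respects (A , _ , lenA) (B , _ , _) (s , shiftAB)
    with blocks-shift (member A) (member B) (N ∸ toℕ s) (member-periodic A) (shift⇒translate A B s shiftAB) (m∸n≤m N (toℕ s))
  ... | X , Y , blocksA , blocksB = length X mod suc r , rotated proj₁ , rotated proj₂
    where
    rotated : ∀ π → rotate (length X mod suc r) (toVecOr 0 (suc r) (map π (blocks (member A))))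
                    ≡ toVecOr 0 (suc r) (map π (blocks (member B)))
    rotated π = subst₂ (λ as bs → rotate (length X mod suc r) (toVecOr 0 (suc r) (map π as)) ≡ toVecOr 0 (suc r) (map π bs))
                  (sym blocksA) (sym blocksB)
                  (rotate-toVecOr-map r π X Y (trans (sym (length-++ X)) (trans (cong length (sym blocksA)) (length-blocks A lenA))))

  toComposition-reflects : ∀ x y → SameRotOrbit (toComposition x) (toComposition y) → SameShiftOrbit x y
  toComposition-reflects (A , _ , lenA) (B , _ , lenB) (j , rot₁ , rot₂) =
    translate⇒shift A B _ (translate-trans A (wordSubset bsB) B _ (m * NB.offset)
      (translate-trans A (wordSubset bsA) (wordSubset bsB) NA.offset (wordLength X) NA.translate wordsRotated)
      (translate-sym B (wordSubset bsB) NB.offset NB.translate))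
    where
    module NA = NormalForm (normalForm′ A lenA)
    module NB = NormalForm (normalForm′ B lenB)
    bsA = blocks (member A)
    bsB = blocks (member B)
    X = L.take (toℕ j) bsA
    Y = L.drop (toℕ j) bsA
    bsA≡XY : bsA ≡ X ++ Y
    bsA≡XY = sym (take++drop≡id (toℕ j) bsA)
    unrotate : ∀ π → rotate j (toVecOr 0 (suc r) (map π bsA)) ≡ toVecOr 0 (suc r) (map π bsB) → map π bsB ≡ map π (Y ++ X)
    unrotate π = rotate-toVecOr-map⁻¹ r π bsA bsB j (length-blocks A lenA) (length-blocks B lenB)
    bsB≡YX : bsB ≡ Y ++ X
    bsB≡YX = map-proj-injective bsB (Y ++ X) (unrotate proj₁ rot₁) (unrotate proj₂ rot₂)
    wordsRotated : Translate (wordSubset bsA) (wordSubset bsB) (wordLength X)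
    wordsRotated = subst₂ (λ as bs → Translate (wordSubset as) (wordSubset bs) (wordLength X)) (sym bsA≡XY) (sym bsB≡YX)
      (wordSubset-rotate X Y (trans (sym (wordLength-++ X Y)) (trans (cong wordLength (sym bsA≡XY)) NA.wordLength≡N)))

  toComposition-surjective : ∀ z → ∃ λ x → SameRotOrbit (toComposition x) z
  toComposition-surjective ((c , c′) , (posc , sumc) , (posc′ , sumc′)) =
    (S , card , len) , F.zero , readBack proj₁ c proj₁-ps , readBack proj₂ c′ proj₂-ps
    where
    ps = V.toList (V.zip c c′)
    pos : LA.All Positive ps
    pos = VAP.toList⁺ (positive-zip posc posc′)
    proj₁-ps : map proj₁ ps ≡ V.toList c
    proj₁-ps = trans (sym (VP.toList-map proj₁ (V.zip c c′))) (cong V.toList (VP.map-proj₁-zip c c′))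
    proj₂-ps : map proj₂ ps ≡ V.toList c′
    proj₂-ps = trans (sym (VP.toList-map proj₂ (V.zip c c′))) (cong V.toList (VP.map-proj₂-zip c c′))
    total : blockTotal ps ≡ k
    total = trans (cong sum proj₁-ps) (trans (sum-toList c) sumc)
    gaps : gapTotal ps ≡ N ∸ k
    gaps = trans (cong sum proj₂-ps) (trans (sum-toList c′) sumc′)
    len≡N : wordLength ps ≡ N
    len≡N = trans (wordLength≡totals ps) (trans (cong₂ _+_ total gaps) (m+[n∸m]≡n k≤N))
    S = wordSubset ps
    blocksS : blocks (member S) ≡ ps
    blocksS = blocks-word (member S) (member-periodic S) ps pos len≡N (member-wordSubset-< ps)
    card : ∣ S ∣ ≡ k
    card = trans (∣∣≡count S) (trans (count-word (member S) ps len≡N (member-wordSubset-< ps)) total)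
    len : length (blockComposition S) ≡ suc r
    len = trans (cong length (blockComposition≡blocks S))
            (trans (length-map proj₁ (blocks (member S))) (trans (cong length blocksS) (VP.length-toList (V.zip c c′))))
    readBack : ∀ π (v : Vec ℕ (suc r)) → map π ps ≡ V.toList v →
               rotate F.zero (toVecOr 0 (suc r) (map π (blocks (member S)))) ≡ v
    readBack π v eq = trans (rotate-zero _)
      (trans (cong (λ qs → toVecOr 0 (suc r) (map π qs)) blocksS) (trans (cong (toVecOr 0 (suc r)) eq) (toVecOr-toList 0 v)))

theorem7p4 : (n k r : ℕ) → 2 ≤ n → 1 ≤ k → k ≤ n ∸ 1 → 1 ≤ r →
    QuotientBijection (TSet n k r) SameShiftOrbit (ZSet n k r) SameRotOrbit
theorem7p4 (suc m) k (suc r) (s≤s _) _ k≤m (s≤s z≤n) =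
  toComposition , toComposition-respects , toComposition-reflects , toComposition-surjective
  where
  open Bijection m r k (m≤n⇒m≤1+n k≤m)
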